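{- Let $G=(U,V,E)$ be a bipartite graph with $|U|=|V|=N$, and run the simplified auction algorithm on $G$. Let $i\geq 0$ be such that $M(i)$ is not a maximum matching of $G$, and let $l$ be an integer. If $v_0\in D_l(i)$ and $(u,v_0)\in M(i)$ for some $u\in U$, then $n_u\subseteq D_{l-1}(i)$.
   Context: For a vertex $w$, $n_w$ denotes its set of neighbours. A vertex is free with respect to a matching $M$ if no edge of $M$ is incident to it. The simplified auction algorithm maintains a matching $M\subseteq E$ and integer values $h_v$, $v\in V$: initially $M=\emptyset$ and $h_v=0$ for all $v$. While $|M|<N$ and $\sum_{v\in V}h_v<N(N-1)$, it performs one iteration: choose (arbitrarily) a free vertex $u\in U$; choose $j\in\arg\min_{v\in n_u}h_v$ (ties arbitrary); if some $u_{old}\in U$ has $(u_{old},j)\in M$, remove that edge; add $(u,j)$ to $M$; set $h_j\leftarrow h_j+1$. $M(i)$ and $h_v(i)$ denote the matching and the values after $i$ iterations. For an integer $l$, $D_l(i)=\{v\in V: h_v(i)\geq l\}$. -}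

module Defs where

open import Data.Nat using (ℕ; zero; suc; _+_; _*_; _∸_; _≤_; _<_)
open import Data.Fin using (Fin; _≟_)
import Data.Fin as F
open import Data.Maybe using (Maybe; just; nothing)
open import Data.Product using (_×_; Σ)
open import Data.Integer as ℤ using (ℤ; +_)
open import Relation.Nullary using (¬_; yes; no)
open import Relation.Binary.PropositionalEquality using (_≡_)

sumFin : ∀ {n} → (Fin n → ℕ) → ℕ
sumFin {zero} f = 0
sumFin {suc n} f = f F.zero + sumFin (λ i → f (F.suc i))

-- A matching is represented by its mate function on U:
-- m u ≡ just v  means  (u , v) ∈ M.
MateFn : ℕ → Set
MateFn N = Fin N → Maybe (Fin N)

isJust : ∀ {A : Set} → Maybe A → ℕ
isJust (just _) = 1
isJust nothing  = 0

size : ∀ {N} → MateFn N → ℕ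
size m = sumFin (λ u → isJust (m u))

-- A bipartite graph G = (U, V, E) with U = V = Fin N, E : U → V → Set.
-- m is a matching of G: all its edges are in E and no two share a V-endpoint
-- (no two share a U-endpoint automatically, by the representation).
IsMatching : ∀ {N} → (Fin N → Fin N → Set) → MateFn N → Set
IsMatching E m =
  (∀ u v → m u ≡ just v → E u v) ×
  (∀ u u' v → m u ≡ just v → m u' ≡ just v → u ≡ u')

IsMaximumMatching : ∀ {N} → (Fin N → Fin N → Set) → MateFn N → Set
IsMaximumMatching E m =
  IsMatching E m × (∀ m' → IsMatching E m' → size m' ≤ size m)

record State (N : ℕ) : Set where
  constructor st
  field
    mate : MateFn N
    h    : Fin N → ℕ
open State public

initial : ∀ {N} → State N
initial = st (λ _ → nothing) (λ _ → 0)

newMate : ∀ {N} → MateFn N → Fin N → Fin N → MateFn N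
newMate m u j w with w ≟ u
... | yes _ = just j
... | no _ with m w
...   | nothing = nothing
...   | just v with v ≟ j
...     | yes _ = nothing
...     | no _ = just v

incr : ∀ {N} → (Fin N → ℕ) → Fin N → Fin N → ℕ
incr h j v with v ≟ j
... | yes _ = suc (h v)
... | no _ = h v

data Step {N : ℕ} (E : Fin N → Fin N → Set) (s : State N) : State N → Set where
  iter : size (mate s) < N →
         sumFin (h s) < N * (N ∸ 1) →
         (u : Fin N) → mate s u ≡ nothing →
         (j : Fin N) → E u j → (∀ v → E u v → h s j ≤ h s v) →
         Step E s (st (newMate (mate s) u j) (incr (h s) j))

-- AfterIters E i s : s is a possible state (M(i), h(i)) after i iterations.
data AfterIters {N : ℕ} (E : Fin N → Fin N → Set) : ℕ → State N → Set where
  start : AfterIters E 0 initial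
  next  : ∀ {i s s'} → AfterIters E i s → Step E s s' → AfterIters E (suc i) s'

InD : ∀ {N} → ℤ → State N → Fin N → Set
InD l s v = l ℤ.≤ + (h s v)

-- Whenever u is matched to v₀, the value of v₀ exceeds the value of any
-- neighbour v of u by at most one.  This invariant holds from the start
-- (nothing is matched) and survives an iteration: the newly matched pair
-- (u, j) has h j ≤ h v for every neighbour v by the choice of j, and h j grows
-- by one; every other surviving pair keeps its V-endpoint, whose value is
-- unchanged, while values never decrease.
module Submission where

open import Defs
open import Data.Nat using (ℕ; suc; _≤_; s≤s)
open import Data.Nat.Properties using (≤-refl; ≤-trans; n≤1+n)
open import Data.Fin using (Fin; _≟_)
open import Data.Maybe using (just; nothing)
open import Data.Product using (_×_; _,_)
open import Data.Sum using (_⊎_; inj₁; inj₂)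
open import Data.Integer using (ℤ; _-_; -_; +_; +≤+)
import Data.Integer as ℤ
import Data.Integer.Properties as ℤₚ
open import Relation.Nullary using (¬_; yes; no; contradiction)
open import Relation.Binary.PropositionalEquality using (_≡_; refl; sym; subst)

incr-≥ : ∀ {N} (h : Fin N → ℕ) j v → h v ≤ incr h j v
incr-≥ h j v with v ≟ j
... | yes _ = n≤1+n _
... | no _  = ≤-refl

incr-≢ : ∀ {N} (h : Fin N → ℕ) {j v} → ¬ v ≡ j → incr h j v ≡ h v
incr-≢ h {j} {v} v≢j with v ≟ j
... | yes v≡j = contradiction v≡j v≢j
... | no _    = refl

incr-self : ∀ {N} (h : Fin N → ℕ) j → incr h j j ≡ suc (h j)
incr-self h j with j ≟ j
... | yes _   = refl
... | no j≢j = contradiction refl j≢j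

newMate-just : ∀ {N} (m : MateFn N) u j {w v} → newMate m u j w ≡ just v →
               (w ≡ u × v ≡ j) ⊎ (m w ≡ just v × ¬ v ≡ j)
newMate-just m u j {w} eq with w ≟ u
newMate-just m u j refl | yes w≡u = inj₁ (w≡u , refl)
... | no _ with m w
newMate-just m u j () | no _ | nothing
... | just v with v ≟ j
newMate-just m u j () | no _ | just v | yes _
newMate-just m u j refl | no _ | just v | no v≢j = inj₂ (refl , v≢j)

MatchedValueBound : ∀ {N} → (Fin N → Fin N → Set) → State N → Set
MatchedValueBound E s =
  ∀ {u v₀ v} → mate s u ≡ just v₀ → E u v → h s v₀ ≤ suc (h s v)

step-preserves-bound : ∀ {N} {E : Fin N → Fin N → Set} {s s'} →
                       MatchedValueBound E s → Step E s s' → MatchedValueBound E s'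
step-preserves-bound {s = s} bound (iter _ _ u _ j _ j-min) {w} {v₀} {v} eq e
  with newMate-just (mate s) u j {w} eq
... | inj₁ (refl , refl) =
  subst (_≤ suc (incr (h s) j v)) (sym (incr-self (h s) j))
        (s≤s (≤-trans (j-min v e) (incr-≥ (h s) j v)))
... | inj₂ (mw , v₀≢j) =
  subst (_≤ suc (incr (h s) j v)) (sym (incr-≢ (h s) v₀≢j))
        (≤-trans (bound mw e) (s≤s (incr-≥ (h s) j v)))

matchedValueBound : ∀ {N} {E : Fin N → Fin N → Set} {i s} →
                    AfterIters E i s → MatchedValueBound E s
matchedValueBound start ()
matchedValueBound (next run step) = step-preserves-bound (matchedValueBound run) step

≤+-suc⇒-1≤+ : ∀ {l : ℤ} {a b} → l ℤ.≤ + a → a ≤ suc b → l - + 1 ℤ.≤ + b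
≤+-suc⇒-1≤+ l≤a a≤1+b = ℤₚ.+-monoˡ-≤ (- + 1) (ℤₚ.≤-trans l≤a (+≤+ a≤1+b))

mainTheorem3 : (N : ℕ) (E : Fin N → Fin N → Set) (i : ℕ) (s : State N) →
    AfterIters E i s →
    ¬ IsMaximumMatching E (mate s) →
    (l : ℤ) (v₀ u : Fin N) →
    InD l s v₀ →
    mate s u ≡ just v₀ →
    ∀ v → E u v → InD (l - + 1) s v
mainTheorem3 N E i s run _ l v₀ u v₀∈D matched v e =
  ≤+-suc⇒-1≤+ v₀∈D (matchedValueBound run matched e)
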